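{- Let \((P,\lambda)\) be a marked poset and let \(\pi\) be the partition of \(P\) generated by the relations \(a\sim p\) and \(p\sim b\) whenever \([a,b]\) is a constant interval containing \(p\). Then \(\pi\) is \((P,\lambda)\)-compatible, the quotient marked poset \((P/\pi,\lambda/\pi)\) is strictly marked, \(F_\pi=\mathcal{O}(P,\lambda)\), and the map \(x\mapsto x\circ q\) (with \(q\colon P\to P/\pi\) the quotient map) is an affine isomorphism \(\mathcal{O}(P/\pi,\lambda/\pi)\cong\mathcal{O}(P,\lambda)\).
   Context: A marked poset \((P,\lambda)\) is a finite poset \(P\) with an induced subposet \(P^*\subseteq P\) of marked elements and an order-preserving map \(\lambda\colon P^*\to\mathbb{R}\); it is strictly marked if \(\lambda(a)<\lambda(b)\) whenever \(a<b\) in \(P^*\). The marked order polyhedron \(\mathcal{O}(P,\lambda)\subseteq\mathbb{R}^P\) is the set of all \(x\in\mathbb{R}^P\) with \(x_p\le x_q\) whenever \(p\le q\) and \(x_a=\lambda(a)\) for \(a\in P^*\). An interval \([a,b]=\{p: a\le p\le b\}\) is constant if \(a,b\in P^*\) and \(\lambda(a)=\lambda(b)\). For a partition \(\pi\), \(F_\pi=\{y\in\mathcal{O}(P,\lambda): y\text{ constant on blocks of }\pi\}\). A partition \(\pi\) is \(P\)-compatible if the transitive closure of "\(B\le C\) if \(p\le q\) for some \(p\in B,q\in C\)" is antisymmetric on blocks (giving a poset \(P/\pi\)); it is \((P,\lambda)\)-compatible if moreover \(\lambda(a)\le\lambda(b)\) whenever \(a\in B\cap P^*\), \(b\in C\cap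 P^*\), \(B\le C\). Then \((P/\pi,\lambda/\pi)\) has marked elements the blocks meeting \(P^*\) and \((\lambda/\pi)(B)=\lambda(a)\) for \(a\in B\cap P^*\). -}

module Defs where

open import Level using (0ℓ)
open import Data.Nat using (ℕ)
open import Data.Fin using (Fin)
open import Data.Product using (Σ; ∃; _×_; _,_)
open import Data.Sum using (_⊎_)
open import Function using (_∘_)
open import Relation.Nullary using (¬_)
open import Relation.Binary.PropositionalEquality using (_≡_)
open import Relation.Binary.Structures using (IsPartialOrder; IsTotalOrder)
open import Relation.Binary.Construct.Closure.Equivalence using (EqClosure)
open import Relation.Binary.Construct.Closure.ReflexiveTransitive using (Star)

-- The value domain (ℝ in the paper): an arbitrary totally ordered set.
record OrderedValues : Set₁ where
  field
    R        : Set
    _≤R_     : R → R → Set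
    isTotal  : IsTotalOrder _≡_ _≤R_

  _<R_ : R → R → Set
  x <R y = (x ≤R y) × ¬ (x ≡ y)

-- A finite marked poset (P, λ), with P = Fin n.
-- Marked elements P* are given by the predicate Marked; the marking λ is
-- given as a function on all of P of which only the values on P* matter.
record MarkedPoset (V : OrderedValues) : Set₁ where
  open OrderedValues V
  field
    n        : ℕ
    _≤P_     : Fin n → Fin n → Set
    isPO     : IsPartialOrder _≡_ _≤P_
    Marked   : Fin n → Set
    mark     : Fin n → R
    mark-mono : ∀ {a b} → Marked a → Marked b → a ≤P b → mark a ≤R mark b

module _ {V : OrderedValues} (P : MarkedPoset V) where
  open OrderedValues V
  open MarkedPoset P

  ConstantInterval : Fin n → Fin n → Set
  ConstantInterval a b = Marked a × Marked b × mark a ≡ mark b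

  Gen : Fin n → Fin n → Set
  Gen x y = ∃ λ a → ∃ λ b → ∃ λ p → ConstantInterval a b × a ≤P p × p ≤P b
            × ((x ≡ a × y ≡ p) ⊎ (x ≡ p × y ≡ b))

  π : Fin n → Fin n → Set
  π = EqClosure Gen

  InO : (Fin n → R) → Set
  InO x = (∀ p p' → p ≤P p' → x p ≤R x p') × (∀ a → Marked a → x a ≡ mark a)

  InFπ : (Fin n → R) → Set
  InFπ x = InO x × (∀ p p' → π p p' → x p ≡ x p')

  IsQuotientMap : ∀ {m} → (Fin n → Fin m) → Set
  IsQuotientMap {m} q = (∀ B → ∃ λ p → q p ≡ B)
                      × (∀ p p' → (q p ≡ q p' → π p p') × (π p p' → q p ≡ q p'))

  module Quotient {m : ℕ} (q : Fin n → Fin m) where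
    BlockRel : Fin m → Fin m → Set
    BlockRel B C = ∃ λ p → ∃ λ p' → q p ≡ B × q p' ≡ C × p ≤P p'

    _≤Q_ : Fin m → Fin m → Set
    _≤Q_ = Star BlockRel

    PCompatible : Set
    PCompatible = ∀ B C → B ≤Q C → C ≤Q B → B ≡ C

    PλCompatible : Set
    PλCompatible = PCompatible
      × (∀ a b → Marked a → Marked b → q a ≤Q q b → mark a ≤R mark b)

    -- (P/π, λ/π) is strictly marked; the marked blocks are those meeting P*,
    -- and (λ/π)(q a) = λ(a) for a ∈ P*
    QuotientStrictlyMarked : Set
    QuotientStrictlyMarked = ∀ a b → Marked a → Marked b
      → (q a ≤Q q b) × ¬ (q a ≡ q b) → mark a <R mark b

    InOQ : (Fin m → R) → Set
    InOQ x = (∀ B C → B ≤Q C → x B ≤R x C)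
           × (∀ a → Marked a → x (q a) ≡ mark a)

    PullbackIso : Set
    PullbackIso =
        (∀ x → InOQ x → InO (x ∘ q))
      × (∀ x x' → InOQ x → InOQ x' → (∀ p → x (q p) ≡ x' (q p)) → ∀ B → x B ≡ x' B)
      × (∀ y → InO y → ∃ λ x → InOQ x × (∀ p → x (q p) ≡ y p))

module Submission where

open import Defs
open import Data.Nat using (ℕ)
open import Data.Fin using (Fin)
open import Data.Product using (_×_; ∃; ∃₂; _,_; proj₁; proj₂)
open import Data.Sum using (_⊎_; inj₁; inj₂)
open import Function using (_∘_)
open import Relation.Binary.Bundles using (Poset)
open import Relation.Binary.Definitions using (Reflexive; Transitive)
open import Relation.Binary.PropositionalEquality using (_≡_; refl; sym; trans; subst)
open import Relation.Binary.Structures using (IsPartialOrder; IsTotalOrder)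
open import Relation.Binary.Construct.Closure.ReflexiveTransitive as Star using (Star; ε; _◅_; _◅◅_)
open import Relation.Binary.Construct.Closure.Symmetric using (SymClosure; fwd; bwd)
import Relation.Binary.Construct.Closure.Equivalence as EqClosure
import Relation.Binary.Reasoning.PartialOrder as PosetReasoning

-- A walk of ≤- and π-steps from x to y (which is what the order on P/π
-- unfolds to) reduces to x ≤ y or to a shortcut x ≤ b, λ b ≤ λ a, a ≤ y
-- through marked b, a: reduced relations compose and include π.  Points of
-- O(P, λ) and the marking λ are monotone along reduced relations.  A cycle
-- through a shortcut traps each of its elements between marks of equal
-- value, i.e. in constant intervals, so it lies in a single block of π; this
-- gives antisymmetry of P/π and strictness of λ/π.

module _ {V : OrderedValues} (P : MarkedPoset V) where
  open OrderedValues V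
  open MarkedPoset P

  private
    module ≤P = IsPartialOrder isPO
    module ≤R = IsTotalOrder isTotal

    ≤R-poset : Poset _ _ _
    ≤R-poset = record { isPartialOrder = ≤R.isPartialOrder }

  open PosetReasoning ≤R-poset

  Shortcut : Fin n → Fin n → Set
  Shortcut x y = ∃₂ λ b a → Marked b × Marked a × x ≤P b × mark b ≤R mark a × a ≤P y

  Reduced : Fin n → Fin n → Set
  Reduced x y = x ≤P y ⊎ Shortcut x y

  reduced-refl : Reflexive Reduced
  reduced-refl = inj₁ ≤P.refl

  reduced-trans : Transitive Reduced
  reduced-trans (inj₁ x≤y) (inj₁ y≤z) = inj₁ (≤P.trans x≤y y≤z)
  reduced-trans (inj₁ x≤y) (inj₂ (b , a , mb , ma , y≤b , b≤a , a≤z)) =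
    inj₂ (b , a , mb , ma , ≤P.trans x≤y y≤b , b≤a , a≤z)
  reduced-trans (inj₂ (b , a , mb , ma , x≤b , b≤a , a≤y)) (inj₁ y≤z) =
    inj₂ (b , a , mb , ma , x≤b , b≤a , ≤P.trans a≤y y≤z)
  reduced-trans (inj₂ (b , a , mb , ma , x≤b , b≤a , a≤y)) (inj₂ (b' , a' , mb' , ma' , y≤b' , b'≤a' , a'≤z)) =
    inj₂ (b , a' , mb , ma' , x≤b , b≤a' , a'≤z)
    where
    b≤a' : mark b ≤R mark a'
    b≤a' = begin
      mark b  ≤⟨ b≤a ⟩
      mark a  ≤⟨ mark-mono ma mb' (≤P.trans a≤y y≤b') ⟩
      mark b' ≤⟨ b'≤a' ⟩
      mark a' ∎

  gen⇒reduced : ∀ {x y} → Gen P x y → Reduced x y × Reduced y x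
  gen⇒reduced (a , b , p , (ma , mb , a≡b) , a≤p , p≤b , inj₁ (refl , refl)) =
    inj₁ a≤p , inj₂ (b , a , mb , ma , p≤b , ≤R.reflexive (sym a≡b) , ≤P.refl)
  gen⇒reduced (a , b , p , (ma , mb , a≡b) , a≤p , p≤b , inj₂ (refl , refl)) =
    inj₁ p≤b , inj₂ (b , a , mb , ma , ≤P.refl , ≤R.reflexive (sym a≡b) , a≤p)

  π⇒reduced : ∀ {x y} → π P x y → Reduced x y
  π⇒reduced = Star.fold Reduced (reduced-trans ∘ symGen⇒reduced) reduced-refl
    where
    symGen⇒reduced : ∀ {x y} → SymClosure (Gen P) x y → Reduced x y
    symGen⇒reduced (fwd g) = proj₁ (gen⇒reduced g)
    symGen⇒reduced (bwd g) = proj₂ (gen⇒reduced g)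

  Step : Fin n → Fin n → Set
  Step x y = x ≤P y ⊎ π P x y

  Walk : Fin n → Fin n → Set
  Walk = Star Step

  step⇒reduced : ∀ {x y} → Step x y → Reduced x y
  step⇒reduced (inj₁ x≤y) = inj₁ x≤y
  step⇒reduced (inj₂ x~y) = π⇒reduced x~y

  walk⇒reduced : ∀ {x y} → Walk x y → Reduced x y
  walk⇒reduced = Star.fold Reduced (reduced-trans ∘ step⇒reduced) reduced-refl

  reduced-mono : ∀ {y p p'} → InO P y → Reduced p p' → y p ≤R y p'
  reduced-mono (mono , _) (inj₁ p≤p') = mono _ _ p≤p'
  reduced-mono {y} {p} {p'} (mono , fixed) (inj₂ (b , a , mb , ma , p≤b , b≤a , a≤p')) = begin
    y p    ≤⟨ mono _ _ p≤b ⟩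
    y b    ≡⟨ fixed b mb ⟩
    mark b ≤⟨ b≤a ⟩
    mark a ≡⟨ fixed a ma ⟨
    y a    ≤⟨ mono _ _ a≤p' ⟩
    y p'   ∎

  reduced-mark-mono : ∀ {a b} → Marked a → Marked b → Reduced a b → mark a ≤R mark b
  reduced-mark-mono ma mb (inj₁ a≤b) = mark-mono ma mb a≤b
  reduced-mark-mono {a} {b} ma mb (inj₂ (b' , a' , mb' , ma' , a≤b' , b'≤a' , a'≤b)) = begin
    mark a  ≤⟨ mark-mono ma mb' a≤b' ⟩
    mark b' ≤⟨ b'≤a' ⟩
    mark a' ≤⟨ mark-mono ma' mb a'≤b ⟩
    mark b  ∎

  π⇒equal : ∀ {y p p'} → InO P y → π P p p' → y p ≡ y p'
  π⇒equal o p~p' =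
    ≤R.antisym (reduced-mono o (π⇒reduced p~p'))
               (reduced-mono o (π⇒reduced (EqClosure.symmetric (Gen P) p~p')))

  HasMarkAbove : Fin n → R → Set
  HasMarkAbove z v = ∃ λ b → Marked b × z ≤P b × mark b ≤R v

  HasMarkBelow : R → Fin n → Set
  HasMarkBelow v z = ∃ λ a → Marked a × a ≤P z × v ≤R mark a

  markAbove-reduced : ∀ {z y v} → Reduced z y → HasMarkAbove y v → HasMarkAbove z v
  markAbove-reduced (inj₁ z≤y) (b , mb , y≤b , b≤v) = b , mb , ≤P.trans z≤y y≤b , b≤v
  markAbove-reduced {v = v} (inj₂ (b' , a' , mb' , ma' , z≤b' , b'≤a' , a'≤y)) (b , mb , y≤b , b≤v) =
    b' , mb' , z≤b' , (begin
      mark b' ≤⟨ b'≤a' ⟩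
      mark a' ≤⟨ mark-mono ma' mb (≤P.trans a'≤y y≤b) ⟩
      mark b  ≤⟨ b≤v ⟩
      v       ∎)

  markBelow-reduced : ∀ {x z v} → Reduced x z → HasMarkBelow v x → HasMarkBelow v z
  markBelow-reduced (inj₁ x≤z) (a , ma , a≤x , v≤a) = a , ma , ≤P.trans a≤x x≤z , v≤a
  markBelow-reduced {v = v} (inj₂ (b' , a' , mb' , ma' , x≤b' , b'≤a' , a'≤z)) (a , ma , a≤x , v≤a) =
    a' , ma' , a'≤z , (begin
      v       ≤⟨ v≤a ⟩
      mark a  ≤⟨ mark-mono ma mb' (≤P.trans a≤x x≤b') ⟩
      mark b' ≤⟨ b'≤a' ⟩
      mark a' ∎)

  constantInterval-squeezed : ∀ {a b v} → Marked a → Marked b → a ≤P b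
    → v ≤R mark a → mark b ≤R v → ConstantInterval P a b
  constantInterval-squeezed ma mb a≤b v≤a b≤v =
    ma , mb , ≤R.antisym (mark-mono ma mb a≤b) (≤R.trans b≤v v≤a)

  constantInterval-π : ∀ {a b x z} → ConstantInterval P a b
    → a ≤P x → x ≤P b → a ≤P z → z ≤P b → π P x z
  constantInterval-π {a} {b} {x} {z} ab a≤x x≤b a≤z z≤b =
    bwd (a , b , x , ab , a≤x , x≤b , inj₁ (refl , refl))
      ◅ fwd (a , b , z , ab , a≤z , z≤b , inj₁ (refl , refl)) ◅ ε

  walk-squeezed⇒π : ∀ {x y v} → Walk x y → HasMarkAbove y v → HasMarkBelow v x → π P x y
  walk-squeezed⇒π ε _ _ = ε
  walk-squeezed⇒π (inj₂ x~z ◅ w) above below =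
    x~z ◅◅ walk-squeezed⇒π w above (markBelow-reduced (π⇒reduced x~z) below)
  walk-squeezed⇒π (inj₁ x≤z ◅ w) above below@(a , ma , a≤x , v≤a) =
    let z~y = walk-squeezed⇒π w above (markBelow-reduced (inj₁ x≤z) below)
        a≤z = ≤P.trans a≤x x≤z
        (b , mb , z≤b , b≤v) = markAbove-reduced (π⇒reduced z~y) above
        ab = constantInterval-squeezed ma mb (≤P.trans a≤z z≤b) v≤a b≤v
    in constantInterval-π ab a≤x (≤P.trans x≤z z≤b) a≤z z≤b ◅◅ z~y

  shortcut-cycle⇒π : ∀ {x y} → Walk x y → Shortcut y x → π P x y
  shortcut-cycle⇒π w (b , a , mb , ma , y≤b , b≤a , a≤x) =
    walk-squeezed⇒π w (b , mb , y≤b , b≤a) (a , ma , a≤x , ≤R.refl)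

  walk-antisym : ∀ {x y} → Walk x y → Walk y x → π P x y
  walk-antisym wxy wyx with walk⇒reduced wxy | walk⇒reduced wyx
  ... | inj₂ sxy | _        = EqClosure.symmetric (Gen P) (shortcut-cycle⇒π wyx sxy)
  ... | inj₁ _   | inj₂ syx = shortcut-cycle⇒π wxy syx
  ... | inj₁ x≤y | inj₁ y≤x = subst (π P _) (≤P.antisym x≤y y≤x) ε

  Fπ⇔O : ∀ x → (InFπ P x → InO P x) × (InO P x → InFπ P x)
  Fπ⇔O x = proj₁ , λ o → o , λ _ _ → π⇒equal o

  module _ {m} {q : Fin n → Fin m} (isQuotient : IsQuotientMap P q) where
    open Quotient P q

    private
      q≡⇒π : ∀ {x y} → q x ≡ q y → π P x y
      q≡⇒π {x} {y} = proj₁ (proj₂ isQuotient x y)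

      π⇒q≡ : ∀ {x y} → π P x y → q x ≡ q y
      π⇒q≡ {x} {y} = proj₂ (proj₂ isQuotient x y)

      rep : Fin m → Fin n
      rep B = proj₁ (proj₁ isQuotient B)

      q∘rep : ∀ B → q (rep B) ≡ B
      q∘rep B = proj₂ (proj₁ isQuotient B)

    ≤Q⇒walk : ∀ {B C x y} → B ≤Q C → q x ≡ B → q y ≡ C → Walk x y
    ≤Q⇒walk ε qx≡B qy≡B = inj₂ (q≡⇒π (trans qx≡B (sym qy≡B))) ◅ ε
    ≤Q⇒walk ((p , p' , qp≡B , qp'≡D , p≤p') ◅ D≤C) qx≡B qy≡C =
      inj₂ (q≡⇒π (trans qx≡B (sym qp≡B))) ◅ inj₁ p≤p' ◅ ≤Q⇒walk D≤C qp'≡D qy≡C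

    ≤Q⇒walk-rep : ∀ {B C} → B ≤Q C → Walk (rep B) (rep C)
    ≤Q⇒walk-rep B≤C = ≤Q⇒walk B≤C (q∘rep _) (q∘rep _)

    π-PCompatible : PCompatible
    π-PCompatible B C B≤C C≤B =
      trans (sym (q∘rep B))
            (trans (π⇒q≡ (walk-antisym (≤Q⇒walk-rep B≤C) (≤Q⇒walk-rep C≤B))) (q∘rep C))

    quotient-mark-mono : ∀ a b → Marked a → Marked b → q a ≤Q q b → mark a ≤R mark b
    quotient-mark-mono a b ma mb qa≤qb =
      reduced-mark-mono ma mb (walk⇒reduced (≤Q⇒walk qa≤qb refl refl))

    quotient-strictlyMarked : QuotientStrictlyMarked
    quotient-strictlyMarked a b ma mb (qa≤qb , qa≢qb) =
      quotient-mark-mono a b ma mb qa≤qb , λ a≡b → qa≢qb (π⇒q≡ (shortcut-cycle⇒π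
        (≤Q⇒walk qa≤qb refl refl) (b , a , mb , ma , ≤P.refl , ≤R.reflexive (sym a≡b) , ≤P.refl)))

    pullback-InO : ∀ x → InOQ x → InO P (x ∘ q)
    pullback-InO x (mono , fixed) = (λ p p' p≤p' → mono _ _ ((p , p' , refl , refl , p≤p') ◅ ε)) , fixed

    pullback-injective : ∀ x x' → InOQ x → InOQ x' → (∀ p → x (q p) ≡ x' (q p)) → ∀ B → x B ≡ x' B
    pullback-injective x x' _ _ x∘q≡x'∘q B = subst (λ C → x C ≡ x' C) (q∘rep B) (x∘q≡x'∘q (rep B))

    pullback-surjective : ∀ y → InO P y → ∃ λ x → InOQ x × (∀ p → x (q p) ≡ y p)
    pullback-surjective y o@(_ , fixed) =
      y ∘ rep , ((λ B C B≤C → reduced-mono o (walk⇒reduced (≤Q⇒walk-rep B≤C))) ,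
                 λ a ma → trans (y∘rep∘q a) (fixed a ma)) , y∘rep∘q
      where
      y∘rep∘q : ∀ p → y (rep (q p)) ≡ y p
      y∘rep∘q p = π⇒equal o (q≡⇒π (q∘rep (q p)))

proposition3p18 : (V : OrderedValues) (P : MarkedPoset V) (m : ℕ)
    (q : Fin (MarkedPoset.n P) → Fin m) → IsQuotientMap P q
    → Quotient.PλCompatible P q
    × Quotient.QuotientStrictlyMarked P q
    × (∀ x → (InFπ P x → InO P x) × (InO P x → InFπ P x))
    × Quotient.PullbackIso P q
proposition3p18 V P m q isQuotient =
    (π-PCompatible P isQuotient , quotient-mark-mono P isQuotient)
  , quotient-strictlyMarked P isQuotient
  , Fπ⇔O P
  , pullback-InO P isQuotient , pullback-injective P isQuotient , pullback-surjective P isQuotient
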